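{- Let $\langle M,\leq_M\rangle$ be a connected cycle-free partial order and let $r\in M$ be fixed by every automorphism of $M$. Let $T(M)$ be the structure on the domain of $M$ with order $\leq_{T(M)}$ and unary predicate $U$ defined as in the context. Then $\langle T(M),\leq_{T(M)},U\rangle$ is a tree.
   Context: All partial orders may carry arbitrarily many unary "colour" predicates, which automorphisms must preserve. For a partial order $M$ let $M^D$ be its Dedekind–MacNeille completion. For $a,b\in M$, a connecting set from $a$ to $b$ is a tuple $\langle c_1,\dots,c_n\rangle$ ($n\ge 2$) with $c_1=a$, $c_n=b$, $c_2,\dots,c_{n-1}\in M^D$, $c_i$ comparable to $c_{i+1}$ for $1\le i\le n-1$, and for $1<i<n$ either $c_{i-1}<c_i>c_{i+1}$ or $c_{i-1}>c_i<c_{i+1}$. A path from $a$ to $b$ is a set $\bigcup_{1\le k<n}\sigma_k$ where each $\sigma_k$ is a maximal chain in $M^D$ with endpoints $c_k,c_{k+1}$, such that if $x\in\sigma_i\cap\sigma_j$ with $i<j$ then $j=i+1$ and $x=c_{i+1}$. $M$ is a cycle-free partial order (CFPO) if between any two points there is at most one path; the unique path between $x,y$ is denoted $\mathrm{path}(x,y)$. $M$ is connected if $\mathrm{path}(x,y)$ exists for all $x,y\in M$. A tree is a partial order in which every set $\{y: y\le x\}$ is linearly ordered and any two elements have a common lower bound. Construction of $T(M)$: same domain as $M$ (colour predicates retained); $r\leq_{T(M)} s$ for all $s$, and $s\leq_{T(M)} t$ iff $s\in\mathrm{path}(r,t)$. Define $X_0=\{t: r\le_M t\}$, $Y_0=\{t: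 t<_M r\}$, and for $n\ge1$: $X_n=\{t:\ y\le_M t$ for some $y\in Y_{n-1}\}\setminus\bigcup_{i<n}(X_i\cup Y_i)$, $Y_n=\{t:\ t<_M x$ for some $x\in X_{n-1}\}\setminus\bigcup_{i<n}(X_i\cup Y_i)$. Let $X=\bigcup_n X_n$, and let $U(t)$ hold iff $t\in X$. -}

module Defs where

open import Level using (Level) renaming (suc to lsuc; zero to lzero)
open import Data.Nat using (ℕ; zero; suc; _<_; _≤_)
open import Data.Product using (Σ; ∃; _×_; _,_)
open import Data.Sum using (_⊎_)
open import Data.Empty using (⊥)
open import Relation.Nullary using (¬_)
open import Relation.Binary.PropositionalEquality using (_≡_; _≢_)
open import Relation.Binary.Structures using (IsPartialOrder)
open import Function.Bundles using (_⇔_; mk⇔)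

record ColouredPO : Set₁ where
  field
    Carrier        : Set
    _≤M_           : Carrier → Carrier → Set
    isPartialOrder : IsPartialOrder _≡_ _≤M_
    Colour         : Set
    col            : Colour → Carrier → Set

module CFPO (M : ColouredPO) where
  open ColouredPO M

  A : Set
  A = Carrier

  _<M_ : A → A → Set
  x <M y = x ≤M y × x ≢ y

  record Automorphism : Set where
    field
      fun      : A → A
      inv      : A → A
      inverseˡ : ∀ x → fun (inv x) ≡ x
      inverseʳ : ∀ x → inv (fun x) ≡ x
      order    : ∀ x y → (x ≤M y) ⇔ (fun x ≤M fun y)
      colours  : ∀ i x → col i x ⇔ col i (fun x)

  -- Dedekind–MacNeille completion M^D (without an added top/bottom)
  UB : (A → Set) → A → Set
  UB S u = ∀ s → S s → s ≤M u

  LB : (A → Set) → A → Set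
  LB S l = ∀ s → S s → l ≤M s

  record Cut : Set₁ where
    field
      set      : A → Set
      closed   : ∀ x → set x ⇔ LB (UB set) x
      nonempty : ∃ set
      bounded  : ∃ (UB set)
  open Cut public

  _⊑_ : Cut → Cut → Set
  c ⊑ d = ∀ x → set c x → set d x

  _≈ᴰ_ : Cut → Cut → Set
  c ≈ᴰ d = c ⊑ d × d ⊑ c

  _⊏_ : Cut → Cut → Set
  c ⊏ d = c ⊑ d × ¬ (d ⊑ c)

  Comparable : Cut → Cut → Set
  Comparable c d = c ⊑ d ⊎ d ⊑ c

  ι : A → Cut
  ι a = record
    { set      = λ x → x ≤M a
    ; closed   = λ x → mk⇔ (λ x≤a u h → h x x≤a) (λ h → h a (λ s p → p))
    ; nonempty = a , IsPartialOrder.refl isPartialOrder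
    ; bounded  = a , (λ s p → p)
    }

  InInterval : Cut → Cut → Cut → Set
  InInterval c d z = (c ⊑ z × z ⊑ d) ⊎ (d ⊑ z × z ⊑ c)

  record IsMaxChain (c d : Cut) (σ : Cut → Set₁) : Set₂ where
    field
      hasˡ     : σ c
      hasʳ     : σ d
      chain    : ∀ x y → σ x → σ y → Comparable x y
      inside   : ∀ z → σ z → InInterval c d z
      maximal  : ∀ z → InInterval c d z → (∀ y → σ y → Comparable z y) → σ z

  -- paths.  A connecting set ⟨c_1,…,c_n⟩ is encoded 0-indexed as
  -- c 0, …, c k with k = n - 1 ≥ 1; σ i is the maximal chain with
  -- endpoints c i, c (suc i) for i < k.
  record IsPath (a b : A) (P : Cut → Set₁) : Set₂ where
    field
      k        : ℕ
      c        : ℕ → Cut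
      σ        : ℕ → Cut → Set₁
      length≥2 : 1 ≤ k
      first    : c 0 ≈ᴰ ι a
      last     : c k ≈ᴰ ι b
      comp     : ∀ i → i < k → Comparable (c i) (c (suc i))
      altern   : ∀ j → suc j < k →
                   (c j ⊏ c (suc j) × c (suc (suc j)) ⊏ c (suc j))
                 ⊎ (c (suc j) ⊏ c j × c (suc j) ⊏ c (suc (suc j)))
      chains   : ∀ i → i < k → IsMaxChain (c i) (c (suc i)) (σ i)
      disjoint : ∀ i j x → i < j → j < k → σ i x → σ j x →
                   j ≡ suc i × x ≈ᴰ c j
      union    : ∀ x → P x ⇔ (∃ λ i → i < k × σ i x)

  IsCFPO : Set₂
  IsCFPO = ∀ a b (P Q : Cut → Set₁) → IsPath a b P → IsPath a b Q →
             ∀ x → P x ⇔ Q x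

  Connected : Set₂
  Connected = ∀ a b → ∃ λ (P : Cut → Set₁) → IsPath a b P

  module T (r : A) where

    _≤T_ : A → A → Set₂
    s ≤T t = s ≡ r ⊎ ∃ λ (P : Cut → Set₁) → IsPath r t P × P (ι s)

    mutual
      Xn : ℕ → A → Set
      Xn zero    t = r ≤M t
      Xn (suc n) t = (∃ λ y → Yn n y × y ≤M t) × ¬ Seen (suc n) t

      Yn : ℕ → A → Set
      Yn zero    t = t <M r
      Yn (suc n) t = (∃ λ x → Xn n x × t <M x) × ¬ Seen (suc n) t

      Seen : ℕ → A → Set
      Seen zero    t = ⊥
      Seen (suc n) t = Seen n t ⊎ Xn n t ⊎ Yn n t

    U : A → Set
    U t = ∃ λ n → Xn n t

record IsTree {ℓ : Level} {B : Set} (_⊴_ : B → B → Set ℓ) : Set ℓ where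
  field
    isPartialOrder : IsPartialOrder _≡_ _⊴_
    downLinear     : ∀ x y z → y ⊴ x → z ⊴ x → y ⊴ z ⊎ z ⊴ y
    commonLower    : ∀ x y → ∃ λ z → z ⊴ x × z ⊴ y

-- The heart of the argument is that
-- an initial segment of a path is again a path: cutting a path from a to b at one of its
-- points x (keeping the chains before x's chain, and x's chain from its first corner up to x)
-- gives a path from a to x, except when x is itself a corner, where one cuts a chain earlier.
-- Uniqueness of paths then identifies path(r, s) with an initial segment of path(r, t)
-- whenever s ∈ path(r, t), which yields transitivity, antisymmetry and linearity of the
-- down-sets; r is least because the only path from r to r is {r}.

module Submission where

open import Defs
open import Axiom.ExcludedMiddle using (ExcludedMiddle)
open import Relation.Binary.PropositionalEquality using (_≡_)

open import Level using (Lift; lift) renaming (suc to lsuc; zero to lzero)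
open import Data.Nat using (ℕ; zero; suc; _<_; _≤_; z≤n; s≤s)
open import Data.Nat.Properties using (≤-refl; ≤-trans; <⇒≢; m≤n⇒m<n∨m≡n; ≤-pred; n≤1+n; <-cmp; m≤n⇒m≤1+n)
open import Data.Product using (∃; _×_; _,_; proj₁; proj₂; map₂)
open import Data.Sum as Sum using (_⊎_; inj₁; inj₂)
open import Data.Empty using (⊥-elim)
open import Data.Unit using (⊤; tt)
open import Relation.Nullary using (¬_; yes; no)
open import Relation.Unary using (Pred; _⊆′_; _≐′_)
open import Relation.Unary.Properties using (⊆′-refl; ⊆′-trans; ≐′-refl; ≐′-sym; ≐′-trans; ⊂′-irrefl)
open import Relation.Binary.PropositionalEquality using (refl; sym; subst; isEquivalence)
open import Relation.Binary.Definitions using (tri<; tri≈; tri>)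
open import Relation.Binary.Structures using (IsPartialOrder)
open import Function.Base using (id)
open import Function.Bundles using (mk⇔; Equivalence)

replaceAfter : {X : Set₁} → ℕ → (ℕ → X) → X → ℕ → X
replaceAfter zero    c e zero    = c zero
replaceAfter zero    c e (suc j) = e
replaceAfter (suc i) c e zero    = c zero
replaceAfter (suc i) c e (suc j) = replaceAfter i (λ n → c (suc n)) e j

replaceAfter-≤ : {X : Set₁} → ∀ i (c : ℕ → X) e j → j ≤ i → replaceAfter i c e j ≡ c j
replaceAfter-≤ zero    c e zero    _         = refl
replaceAfter-≤ (suc i) c e zero    _         = refl
replaceAfter-≤ (suc i) c e (suc j) (s≤s j≤i) = replaceAfter-≤ i (λ n → c (suc n)) e j j≤i

replaceAfter-suc : {X : Set₁} → ∀ i (c : ℕ → X) e → replaceAfter i c e (suc i) ≡ e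
replaceAfter-suc zero    c e = refl
replaceAfter-suc (suc i) c e = replaceAfter-suc i (λ n → c (suc n)) e

-- Stated for predicates rather than cuts: ⊑ and InInterval unfold to these, and unlike cuts
-- the predicates are inferable as implicit arguments.
module Betweenness {A : Set} where

  Between : Pred A lzero → Pred A lzero → Pred A lzero → Set
  Between P Q Z = (P ⊆′ Z × Z ⊆′ Q) ⊎ (Q ⊆′ Z × Z ⊆′ P)

  Comparable′ : Pred A lzero → Pred A lzero → Set
  Comparable′ P Q = P ⊆′ Q ⊎ Q ⊆′ P

  private variable
    P Q U W X Z Z′ : Pred A lzero

  comparable-respˡ-≐′ : Comparable′ U W → U ≐′ Z → Comparable′ Z W
  comparable-respˡ-≐′ (inj₁ U⊆W) (_ , Z⊆U) = inj₁ (⊆′-trans Z⊆U U⊆W)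
  comparable-respˡ-≐′ (inj₂ W⊆U) (U⊆Z , _) = inj₂ (⊆′-trans W⊆U U⊆Z)

  between-respᵐ-≐′ : Between P Q Z → Z ≐′ Z′ → Between P Q Z′
  between-respᵐ-≐′ (inj₁ (P⊆Z , Z⊆Q)) (Z⊆Z′ , Z′⊆Z) =
    inj₁ (⊆′-trans P⊆Z Z⊆Z′ , ⊆′-trans Z′⊆Z Z⊆Q)
  between-respᵐ-≐′ (inj₂ (Q⊆Z , Z⊆P)) (Z⊆Z′ , Z′⊆Z) =
    inj₂ (⊆′-trans Q⊆Z Z⊆Z′ , ⊆′-trans Z′⊆Z Z⊆P)

  between-respʳ-≐′ : Between P Q Z → Q ≐′ W → Between P W Z
  between-respʳ-≐′ (inj₁ (P⊆Z , Z⊆Q)) (Q⊆W , _) = inj₁ (P⊆Z , ⊆′-trans Z⊆Q Q⊆W)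
  between-respʳ-≐′ (inj₂ (Q⊆Z , Z⊆P)) (_ , W⊆Q) = inj₂ (⊆′-trans W⊆Q Q⊆Z , Z⊆P)

  between⇒comparable : Between P Q Z → Comparable′ P Z
  between⇒comparable (inj₁ (P⊆Z , _)) = inj₁ P⊆Z
  between⇒comparable (inj₂ (_ , Z⊆P)) = inj₂ Z⊆P

  between-left : Comparable′ P Q → Between P Q P
  between-left (inj₁ P⊆Q) = inj₁ (⊆′-refl , P⊆Q)
  between-left (inj₂ Q⊆P) = inj₂ (Q⊆P , ⊆′-refl)

  between-right : Comparable′ P Q → Between P Q Q
  between-right (inj₁ P⊆Q) = inj₁ (P⊆Q , ⊆′-refl)
  between-right (inj₂ Q⊆P) = inj₂ (⊆′-refl , Q⊆P)

  between-upward : Between P Q Z → P ⊆′ Q → P ⊆′ Z × Z ⊆′ Q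
  between-upward (inj₁ P⊆Z⊆Q)      _    = P⊆Z⊆Q
  between-upward (inj₂ (Q⊆Z , Z⊆P)) P⊆Q = ⊆′-trans P⊆Q Q⊆Z , ⊆′-trans Z⊆P P⊆Q

  between-downward : Between P Q Z → Q ⊆′ P → Q ⊆′ Z × Z ⊆′ P
  between-downward (inj₁ (P⊆Z , Z⊆Q)) Q⊆P = ⊆′-trans Q⊆P P⊆Z , ⊆′-trans Z⊆Q Q⊆P
  between-downward (inj₂ Q⊆Z⊆P)      _    = Q⊆Z⊆P

  between-trans : Between P Q X → Between P X Z → Between P Q Z
  between-trans (inj₁ (P⊆X , X⊆Q)) (inj₁ (P⊆Z , Z⊆X)) = inj₁ (P⊆Z , ⊆′-trans Z⊆X X⊆Q)
  between-trans (inj₁ (P⊆X , X⊆Q)) (inj₂ (X⊆Z , Z⊆P)) =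
    inj₁ (⊆′-trans P⊆X X⊆Z , ⊆′-trans Z⊆P (⊆′-trans P⊆X X⊆Q))
  between-trans (inj₂ (Q⊆X , X⊆P)) (inj₁ (P⊆Z , Z⊆X)) =
    inj₂ (⊆′-trans Q⊆X (⊆′-trans X⊆P P⊆Z) , ⊆′-trans Z⊆X X⊆P)
  between-trans (inj₂ (Q⊆X , X⊆P)) (inj₂ (X⊆Z , Z⊆P)) = inj₂ (⊆′-trans Q⊆X X⊆Z , Z⊆P)

  between-antisym : Between P Q X → Between P X Q → X ≐′ Q
  between-antisym (inj₁ (_ , X⊆Q)) (inj₁ (_ , Q⊆X)) = X⊆Q , Q⊆X
  between-antisym (inj₁ (P⊆X , X⊆Q)) (inj₂ (_ , Q⊆P)) = X⊆Q , ⊆′-trans Q⊆P P⊆X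
  between-antisym (inj₂ (Q⊆X , X⊆P)) (inj₁ (P⊆Q , _)) = ⊆′-trans X⊆P P⊆Q , Q⊆X
  between-antisym (inj₂ (Q⊆X , _)) (inj₂ (X⊆Q , _)) = X⊆Q , Q⊆X

  between-linear : Between P Q U → Between P Q W → Comparable′ U W →
                   Between P W U ⊎ Between P U W
  between-linear (inj₁ (P⊆U , _)) _  (inj₁ U⊆W) = inj₁ (inj₁ (P⊆U , U⊆W))
  between-linear (inj₂ (_ , U⊆P)) _  (inj₂ W⊆U) = inj₁ (inj₂ (W⊆U , U⊆P))
  between-linear {W = W} (inj₁ (P⊆U , U⊆Q)) BW (inj₂ W⊆U) =
    inj₂ (inj₁ (proj₁ (between-upward {Z = W} BW (⊆′-trans P⊆U U⊆Q)) , W⊆U))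
  between-linear {W = W} (inj₂ (Q⊆U , U⊆P)) BW (inj₁ U⊆W) =
    inj₂ (inj₂ (U⊆W , proj₂ (between-downward {Z = W} BW (⊆′-trans Q⊆U U⊆P))))

  between-collapse : Between P Q Z → Q ≐′ P → Z ≐′ P
  between-collapse (inj₁ (P⊆Z , Z⊆Q)) (Q⊆P , _) = ⊆′-trans Z⊆Q Q⊆P , P⊆Z
  between-collapse (inj₂ (Q⊆Z , Z⊆P)) (_ , P⊆Q) = Z⊆P , ⊆′-trans P⊆Q Q⊆Z

1≤⇒suc : ∀ {n} → 1 ≤ n → ∃ λ m → suc m ≡ n
1≤⇒suc {suc m} _ = m , refl

module Paths (M : ColouredPO) where
  open ColouredPO M
  open CFPO M
  open Betweenness {A}
  private module PO = IsPartialOrder isPartialOrder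

  ι-injective : ∀ {s t} → ι s ≈ᴰ ι t → s ≡ t
  ι-injective {s} {t} (s⊑t , t⊑s) = PO.antisym (s⊑t s PO.refl) (t⊑s t PO.refl)

  maxChain-resp-≈ᴰ : ∀ {c d σ y z} → IsMaxChain c d σ → σ y → y ≈ᴰ z → σ z
  maxChain-resp-≈ᴰ {y = y} {z} σ-max y∈σ y≈z =
    maximal z (between-respᵐ-≐′ (inside y y∈σ) y≈z)
      (λ w w∈σ → comparable-respˡ-≐′ (chain y w y∈σ w∈σ) y≈z)
    where open IsMaxChain σ-max

  singletonChain : ∀ a → IsMaxChain (ι a) (ι a) (λ z → Lift (lsuc lzero) (z ≈ᴰ ι a))
  singletonChain a = record
    { hasˡ    = lift ≐′-refl
    ; hasʳ    = lift ≐′-refl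
    ; chain   = λ { _ _ (lift (u⊑a , _)) (lift (_ , a⊑v)) → inj₁ (⊆′-trans u⊑a a⊑v) }
    ; inside  = λ { _ (lift (z⊑a , a⊑z)) → inj₁ (a⊑z , z⊑a) }
    ; maximal = λ { _ (inj₁ (a⊑z , z⊑a)) _ → lift (z⊑a , a⊑z)
                  ; _ (inj₂ (a⊑z , z⊑a)) _ → lift (z⊑a , a⊑z) }
    }

  singletonPath : ∀ a → IsPath a a (λ z → ∃ λ i → i < 1 × Lift (lsuc lzero) (z ≈ᴰ ι a))
  singletonPath a = record
    { k        = 1
    ; c        = λ _ → ι a
    ; σ        = λ _ z → Lift (lsuc lzero) (z ≈ᴰ ι a)
    ; length≥2 = ≤-refl
    ; first    = ≐′-refl
    ; last     = ≐′-refl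
    ; comp     = λ _ _ → inj₁ ⊆′-refl
    ; altern   = λ { _ (s≤s ()) }
    ; chains   = λ _ _ → singletonChain a
    ; disjoint = λ { _ (suc _) _ _ (s≤s ()) _ _ }
    ; union    = λ _ → mk⇔ id id
    }

  OnPath : A → A → A → Set₂
  OnPath a b s = ∃ λ (P : Cut → Set₁) → IsPath a b P × P (ι s)

  module Along {a b : A} {P : Cut → Set₁} (p : IsPath a b P) where
    open IsPath p

    consecutive-distinct : ∀ j → suc j < k → ¬ (c j ≈ᴰ c (suc j))
    consecutive-distinct j sj<k cⱼ≈cⱼ₊₁ with altern j sj<k
    ... | inj₁ (cⱼ⊏ , _) = ⊂′-irrefl cⱼ≈cⱼ₊₁ cⱼ⊏
    ... | inj₂ (⊏cⱼ , _) = ⊂′-irrefl (≐′-sym cⱼ≈cⱼ₊₁) ⊏cⱼ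

    consecutive-distinct′ : ∀ j → suc j < k → ¬ (c (suc j) ≈ᴰ c (suc (suc j)))
    consecutive-distinct′ j sj<k cⱼ₊₁≈cⱼ₊₂ with altern j sj<k
    ... | inj₁ (_ , ⊏cⱼ₊₁) = ⊂′-irrefl (≐′-sym cⱼ₊₁≈cⱼ₊₂) ⊏cⱼ₊₁
    ... | inj₂ (_ , cⱼ₊₁⊏) = ⊂′-irrefl cⱼ₊₁≈cⱼ₊₂ cⱼ₊₁⊏

    chain⊆path : ∀ j z → j < k → σ j z → P z
    chain⊆path j z j<k z∈σⱼ = Equivalence.from (union z) (j , j<k , z∈σⱼ)

    lastChain-has-end : ∀ m → suc m ≡ k → σ m (ι b)
    lastChain-has-end m sm≡k =
      maxChain-resp-≈ᴰ (chains m m<k) (IsMaxChain.hasʳ (chains m m<k))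
        (subst (λ n → c n ≈ᴰ ι b) (sym sm≡k) last)
      where
        m<k : m < k
        m<k = subst (m <_) sm≡k ≤-refl

    path-has-end : P (ι b)
    path-has-end with 1≤⇒suc length≥2
    ... | m , sm≡k = chain⊆path m (ι b) (subst (m <_) sm≡k ≤-refl) (lastChain-has-end m sm≡k)

    end-on-chain⇒last : ∀ j → j < k → σ j (ι b) → suc j ≡ k
    end-on-chain⇒last j j<k b∈σⱼ with 1≤⇒suc length≥2
    ... | m , sm≡k with m≤n⇒m<n∨m≡n (≤-pred (subst (j <_) (sym sm≡k) j<k))
    ...   | inj₂ refl = sm≡k
    ...   | inj₁ j<m with disjoint j m (ι b) j<m (subst (m <_) sm≡k ≤-refl) b∈σⱼ (lastChain-has-end m sm≡k)
    ...     | refl , b≈cₘ = ⊥-elim (consecutive-distinct′ j (subst (m <_) sm≡k ≤-refl)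
                                     (≐′-trans (≐′-sym b≈cₘ) (≐′-sym cₘ₊₁≈b)))
      where
        cₘ₊₁≈b : c (suc m) ≈ᴰ ι b
        cₘ₊₁≈b = subst (λ n → c n ≈ᴰ ι b) (sym sm≡k) last

    NotTurningAt : ℕ → A → Set
    NotTurningAt zero    x = ⊤
    NotTurningAt (suc i) x = ¬ (ι x ≈ᴰ c (suc i))

    record InitialSegment (i : ℕ) (x : A) : Set₂ where
      field
        points   : Cut → Set₁
        isPath   : IsPath a x points
        ⊇-before : ∀ j z → j < i → σ j z → points z
        ⊇-last   : ∀ z → σ i z → InInterval (c i) (ι x) z → points z
        ⊆-pieces : ∀ z → points z →
                     (∃ λ j → j < i × σ j z) ⊎ (σ i z × InInterval (c i) (ι x) z)
    open InitialSegment

    module Segment {i} (i<k : i < k) {x} (x∈σᵢ : σ i (ι x)) where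
      private module Hᵢ = IsMaxChain (chains i i<k)

      piece : ℕ → Cut → Set₁
      piece j z = σ j z × (j ≡ i → InInterval (c i) (ι x) z)

      corner : ℕ → Cut
      corner = replaceAfter i c (ι x)

      segment : Cut → Set₁
      segment z = ∃ λ j → j < suc i × piece j z

      x-between : InInterval (c i) (c (suc i)) (ι x)
      x-between = Hᵢ.inside (ι x) x∈σᵢ

      cᵢ~x : Comparable (c i) (ι x)
      cᵢ~x = between⇒comparable x-between

      corner-comparable : ∀ j → j < suc i → Comparable (corner j) (corner (suc j))
      corner-comparable j (s≤s j≤i) with m≤n⇒m<n∨m≡n j≤i
      ... | inj₁ j<i rewrite replaceAfter-≤ i c (ι x) j j≤i | replaceAfter-≤ i c (ι x) (suc j) j<i =
        comp j (≤-trans (s≤s j≤i) i<k)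
      ... | inj₂ refl rewrite replaceAfter-≤ j c (ι x) j ≤-refl | replaceAfter-suc j c (ι x) = cᵢ~x

      piece-before : ∀ j → j < i → IsMaxChain (c j) (c (suc j)) (piece j)
      piece-before j j<i = record
        { hasˡ    = H.hasˡ , j≢i (c j)
        ; hasʳ    = H.hasʳ , j≢i (c (suc j))
        ; chain   = λ u v u∈ v∈ → H.chain u v (proj₁ u∈) (proj₁ v∈)
        ; inside  = λ z z∈ → H.inside z (proj₁ z∈)
        ; maximal = λ z z-in z~ → H.maximal z z-in (λ y y∈σ → z~ y (y∈σ , j≢i y)) , j≢i z
        }
        where
          module H = IsMaxChain (chains j (≤-trans (m≤n⇒m≤1+n j<i) i<k))
          j≢i : ∀ z → j ≡ i → InInterval (c i) (ι x) z
          j≢i _ j≡i = ⊥-elim (<⇒≢ j<i j≡i)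

      piece-last : IsMaxChain (c i) (ι x) (piece i)
      piece-last = record
        { hasˡ    = Hᵢ.hasˡ , λ _ → between-left cᵢ~x
        ; hasʳ    = x∈σᵢ , λ _ → between-right cᵢ~x
        ; chain   = λ u v u∈ v∈ → Hᵢ.chain u v (proj₁ u∈) (proj₁ v∈)
        ; inside  = λ z z∈ → proj₂ z∈ refl
        ; maximal = λ z z-in z~ →
            Hᵢ.maximal z (between-trans x-between z-in) (comparable-to-chain z z-in z~) , λ _ → z-in
        }
        where
          -- a point of σ i outside [c i, x] lies beyond x, hence is comparable to all of [c i, x]
          comparable-to-chain : ∀ z → InInterval (c i) (ι x) z → (∀ y → piece i y → Comparable z y) →
                                ∀ y → σ i y → Comparable z y
          comparable-to-chain z z-in z~ y y∈σ with x-between | Hᵢ.chain y (ι x) y∈σ x∈σᵢ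
          ... | inj₁ (cᵢ⊑x , x⊑cᵢ₊₁) | inj₁ y⊑x =
            z~ y (y∈σ , λ _ → inj₁ (proj₁ (between-upward (Hᵢ.inside y y∈σ) (⊆′-trans cᵢ⊑x x⊑cᵢ₊₁))
                                   , y⊑x))
          ... | inj₁ (cᵢ⊑x , _) | inj₂ x⊑y = inj₁ (⊆′-trans (proj₂ (between-upward z-in cᵢ⊑x)) x⊑y)
          ... | inj₂ (cᵢ₊₁⊑x , x⊑cᵢ) | inj₂ x⊑y =
            z~ y (y∈σ , λ _ → inj₂ (x⊑y
                                   , proj₂ (between-downward (Hᵢ.inside y y∈σ) (⊆′-trans cᵢ₊₁⊑x x⊑cᵢ))))
          ... | inj₂ (_ , x⊑cᵢ) | inj₁ y⊑x = inj₂ (⊆′-trans y⊑x (proj₁ (between-downward z-in x⊑cᵢ)))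

      piece-maxChain : ∀ j → j < suc i → IsMaxChain (corner j) (corner (suc j)) (piece j)
      piece-maxChain j (s≤s j≤i) with m≤n⇒m<n∨m≡n j≤i
      ... | inj₁ j<i rewrite replaceAfter-≤ i c (ι x) j j≤i | replaceAfter-≤ i c (ι x) (suc j) j<i =
        piece-before j j<i
      ... | inj₂ refl rewrite replaceAfter-≤ j c (ι x) j ≤-refl | replaceAfter-suc j c (ι x) = piece-last

      corner-alternates : NotTurningAt i x → ∀ j → suc j < suc i →
          (corner j ⊏ corner (suc j) × corner (suc (suc j)) ⊏ corner (suc j))
        ⊎ (corner (suc j) ⊏ corner j × corner (suc j) ⊏ corner (suc (suc j)))
      corner-alternates fresh j (s≤s sj≤i) with m≤n⇒m<n∨m≡n sj≤i
      ... | inj₁ sj<i rewrite replaceAfter-≤ i c (ι x) j (≤-trans (n≤1+n j) sj≤i)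
                            | replaceAfter-≤ i c (ι x) (suc j) sj≤i
                            | replaceAfter-≤ i c (ι x) (suc (suc j)) sj<i =
        altern j (≤-trans (s≤s sj≤i) i<k)
      ... | inj₂ refl rewrite replaceAfter-≤ (suc j) c (ι x) j (n≤1+n j)
                            | replaceAfter-≤ (suc j) c (ι x) (suc j) ≤-refl
                            | replaceAfter-suc (suc j) c (ι x) =
        turn (altern j i<k) x-between
        where
          -- x takes the place of the corner c (suc (suc j)); NotTurningAt makes its
          -- comparison with c (suc j) strict
          turn : (c j ⊏ c (suc j) × c (suc (suc j)) ⊏ c (suc j))
               ⊎ (c (suc j) ⊏ c j × c (suc j) ⊏ c (suc (suc j))) →
                 InInterval (c (suc j)) (c (suc (suc j))) (ι x) →
                 (c j ⊏ c (suc j) × ι x ⊏ c (suc j)) ⊎ (c (suc j) ⊏ c j × c (suc j) ⊏ ι x)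
          turn (inj₁ (_ , _ , cⱼ₊₁⋢cⱼ₊₂)) (inj₁ (cⱼ₊₁⊑x , x⊑cⱼ₊₂)) =
            ⊥-elim (cⱼ₊₁⋢cⱼ₊₂ (⊆′-trans cⱼ₊₁⊑x x⊑cⱼ₊₂))
          turn (inj₁ (up , _)) (inj₂ (_ , x⊑cⱼ₊₁)) =
            inj₁ (up , x⊑cⱼ₊₁ , λ cⱼ₊₁⊑x → fresh (x⊑cⱼ₊₁ , cⱼ₊₁⊑x))
          turn (inj₂ (down , _)) (inj₁ (cⱼ₊₁⊑x , _)) =
            inj₂ (down , cⱼ₊₁⊑x , λ x⊑cⱼ₊₁ → fresh (x⊑cⱼ₊₁ , cⱼ₊₁⊑x))
          turn (inj₂ (_ , _ , cⱼ₊₂⋢cⱼ₊₁)) (inj₂ (cⱼ₊₂⊑x , x⊑cⱼ₊₁)) =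
            ⊥-elim (cⱼ₊₂⋢cⱼ₊₁ (⊆′-trans cⱼ₊₂⊑x x⊑cⱼ₊₁))

      piece-disjoint : ∀ j₁ j₂ z → j₁ < j₂ → j₂ < suc i → piece j₁ z → piece j₂ z →
                       j₂ ≡ suc j₁ × z ≈ᴰ corner j₂
      piece-disjoint j₁ j₂ z j₁<j₂ j₂≤i (z∈σⱼ₁ , _) (z∈σⱼ₂ , _) =
        map₂ (subst (z ≈ᴰ_) (sym (replaceAfter-≤ i c (ι x) j₂ (≤-pred j₂≤i))))
             (disjoint j₁ j₂ z j₁<j₂ (≤-trans j₂≤i i<k) z∈σⱼ₁ z∈σⱼ₂)

      segment-isPath : NotTurningAt i x → IsPath a x segment
      segment-isPath fresh = record
        { k        = suc i
        ; c        = corner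
        ; σ        = piece
        ; length≥2 = s≤s z≤n
        ; first    = subst (_≈ᴰ ι a) (sym (replaceAfter-≤ i c (ι x) 0 z≤n)) first
        ; last     = subst (_≈ᴰ ι x) (sym (replaceAfter-suc i c (ι x))) ≐′-refl
        ; comp     = corner-comparable
        ; altern   = corner-alternates fresh
        ; chains   = piece-maxChain
        ; disjoint = piece-disjoint
        ; union    = λ _ → mk⇔ id id
        }

      initialSegment : NotTurningAt i x → InitialSegment i x
      initialSegment fresh = record
        { points   = segment
        ; isPath   = segment-isPath fresh
        ; ⊇-before = λ j z j<i z∈σⱼ → j , m≤n⇒m≤1+n j<i , z∈σⱼ , λ j≡i → ⊥-elim (<⇒≢ j<i j≡i)
        ; ⊇-last   = λ z z∈σᵢ z-in → i , ≤-refl , z∈σᵢ , λ _ → z-in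
        ; ⊆-pieces = pieces
        }
        where
          pieces : ∀ z → segment z → (∃ λ j → j < i × σ j z) ⊎ (σ i z × InInterval (c i) (ι x) z)
          pieces z (j , s≤s j≤i , z∈σⱼ , z-in) with m≤n⇒m<n∨m≡n j≤i
          ... | inj₁ j<i  = inj₁ (j , j<i , z∈σⱼ)
          ... | inj₂ refl = inj₂ (z∈σⱼ , z-in refl)

    segment-stepBack : ∀ {i x} → suc i < k → ι x ≈ᴰ c (suc i) → InitialSegment i x → InitialSegment (suc i) x
    segment-stepBack {i} {x} si<k x≈cᵢ₊₁ S = record
      { points   = points S
      ; isPath   = isPath S
      ; ⊇-before = before
      ; ⊇-last   = λ z _ z-in → before i z ≤-refl (∈σᵢ (between-collapse z-in x≈cᵢ₊₁))
      ; ⊆-pieces = λ z z∈ → inj₁ (weaken (⊆-pieces S z z∈))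
      }
      where
        i<k : i < k
        i<k = ≤-trans (n≤1+n (suc i)) si<k
        module Hᵢ = IsMaxChain (chains i i<k)

        ∈σᵢ : ∀ {z} → z ≈ᴰ c (suc i) → σ i z
        ∈σᵢ z≈cᵢ₊₁ = maxChain-resp-≈ᴰ (chains i i<k) Hᵢ.hasʳ (≐′-sym z≈cᵢ₊₁)

        before : ∀ j z → j < suc i → σ j z → points S z
        before j z (s≤s j≤i) z∈σⱼ with m≤n⇒m<n∨m≡n j≤i
        ... | inj₁ j<i  = ⊇-before S j z j<i z∈σⱼ
        ... | inj₂ refl = ⊇-last S z z∈σⱼ (between-respʳ-≐′ (Hᵢ.inside z z∈σⱼ) (≐′-sym x≈cᵢ₊₁))

        weaken : ∀ {z} → (∃ λ j → j < i × σ j z) ⊎ (σ i z × InInterval (c i) (ι x) z) →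
                 ∃ λ j → j < suc i × σ j z
        weaken (inj₁ (j , j<i , z∈σⱼ)) = j , m≤n⇒m≤1+n j<i , z∈σⱼ
        weaken (inj₂ (z∈σᵢ , _))       = i , ≤-refl , z∈σᵢ

    notTurning-before : ∀ i {x} → suc i < k → ι x ≈ᴰ c (suc i) → NotTurningAt i x
    notTurning-before zero    _    _         = tt
    notTurning-before (suc i) si<k x≈cᵢ₊₂ x≈cᵢ₊₁ =
      consecutive-distinct (suc i) si<k (≐′-trans (≐′-sym x≈cᵢ₊₁) x≈cᵢ₊₂)

    -- If x coincides with the corner c i (i > 0) the cut connecting set would not alternate; x is then the far
    -- end of chain i − 1 and we cut there instead.  Telling the two cases apart needs excluded middle.
    initialSegmentAt : ExcludedMiddle lzero → ∀ i → i < k → ∀ x → σ i (ι x) → InitialSegment i x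
    initialSegmentAt lem zero    i<k  x x∈σ = Segment.initialSegment i<k x∈σ tt
    initialSegmentAt lem (suc i) si<k x x∈σ with lem {ι x ≈ᴰ c (suc i)}
    ... | no  x≉cᵢ₊₁ = Segment.initialSegment si<k x∈σ x≉cᵢ₊₁
    ... | yes x≈cᵢ₊₁ = segment-stepBack si<k x≈cᵢ₊₁
                         (Segment.initialSegment i<k x∈σᵢ (notTurning-before i si<k x≈cᵢ₊₁))
      where
        i<k : i < k
        i<k = ≤-trans (n≤1+n (suc i)) si<k
        x∈σᵢ : σ i (ι x)
        x∈σᵢ = maxChain-resp-≈ᴰ (chains i i<k) (IsMaxChain.hasʳ (chains i i<k)) (≐′-sym x≈cᵢ₊₁)

    initialPath-⊆ : ExcludedMiddle lzero → ∀ {x} → P (ι x) → ∃ λ R → IsPath a x R × (∀ z → R z → P z)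
    initialPath-⊆ lem {x} x∈P with Equivalence.to (union (ι x)) x∈P
    ... | i , i<k , x∈σᵢ = points S , isPath S , ⊆P
      where
        S : InitialSegment i x
        S = initialSegmentAt lem i i<k x x∈σᵢ
        ⊆P : ∀ z → points S z → P z
        ⊆P z z∈S with ⊆-pieces S z z∈S
        ... | inj₁ (j , j<i , z∈σⱼ) = chain⊆path j z (≤-trans (m≤n⇒m≤1+n j<i) i<k) z∈σⱼ
        ... | inj₂ (z∈σᵢ , _)       = chain⊆path i z i<k z∈σᵢ

    initialPath-end : ExcludedMiddle lzero → ∀ {x} → P (ι x) → ∃ λ R → IsPath a x R × (R (ι b) → x ≡ b)
    initialPath-end lem {x} x∈P with Equivalence.to (union (ι x)) x∈P
    ... | i , i<k , x∈σᵢ = points S , isPath S , ends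
      where
        S : InitialSegment i x
        S = initialSegmentAt lem i i<k x x∈σᵢ
        ends : points S (ι b) → x ≡ b
        ends b∈S with ⊆-pieces S (ι b) b∈S
        ... | inj₁ (j , j<i , b∈σⱼ) =
          ⊥-elim (<⇒≢ (≤-trans (s≤s j<i) i<k) (end-on-chain⇒last j (≤-trans (m≤n⇒m≤1+n j<i) i<k) b∈σⱼ))
        ... | inj₂ (b∈σᵢ , b-in) = ι-injective (between-antisym x-in b-in)
          where
            x-in : InInterval (c i) (ι b) (ι x)
            x-in = between-respʳ-≐′ (IsMaxChain.inside (chains i i<k) (ι x) x∈σᵢ)
                     (subst (λ n → c n ≈ᴰ ι b) (sym (end-on-chain⇒last i i<k b∈σᵢ)) last)

    onPath-earlierChain : ExcludedMiddle lzero → ∀ {i j y z} → j < k → σ j (ι z) → i < j → σ i (ι y) →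
                          OnPath a z y
    onPath-earlierChain lem {i} {j} {y} {z} j<k z∈σⱼ i<j y∈σᵢ =
      points S , isPath S , ⊇-before S i (ι y) i<j y∈σᵢ
      where
        S : InitialSegment j z
        S = initialSegmentAt lem j j<k z z∈σⱼ

    onPath-sameChain : ExcludedMiddle lzero → ∀ {i y z} → i < k → σ i (ι z) → σ i (ι y) →
                       InInterval (c i) (ι z) (ι y) → OnPath a z y
    onPath-sameChain lem {i} {y} {z} i<k z∈σᵢ y∈σᵢ y-in =
      points S , isPath S , ⊇-last S (ι y) y∈σᵢ y-in
      where
        S : InitialSegment i z
        S = initialSegmentAt lem i i<k z z∈σᵢ

    path-points-linear : ExcludedMiddle lzero → ∀ {y z} → P (ι y) → P (ι z) → OnPath a z y ⊎ OnPath a y z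
    path-points-linear lem {y} {z} y∈P z∈P
      with Equivalence.to (union (ι y)) y∈P | Equivalence.to (union (ι z)) z∈P
    ... | i , i<k , y∈σᵢ | j , j<k , z∈σⱼ with <-cmp i j
    ...   | tri< i<j _ _ = inj₁ (onPath-earlierChain lem j<k z∈σⱼ i<j y∈σᵢ)
    ...   | tri> _ _ j<i = inj₂ (onPath-earlierChain lem i<k y∈σᵢ j<i z∈σⱼ)
    ...   | tri≈ _ refl _ with between-linear (Hᵢ.inside (ι y) y∈σᵢ) (Hᵢ.inside (ι z) z∈σⱼ)
                                              (Hᵢ.chain (ι y) (ι z) y∈σᵢ z∈σⱼ)
      where module Hᵢ = IsMaxChain (chains i i<k)
    ...     | inj₁ y-in = inj₁ (onPath-sameChain lem i<k z∈σⱼ y∈σᵢ y-in)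
    ...     | inj₂ z-in = inj₂ (onPath-sameChain lem i<k y∈σᵢ z∈σⱼ z-in)

  onPath-refl : Connected → ∀ a b → OnPath a b b
  onPath-refl conn a b with conn a b
  ... | P , p = P , p , Along.path-has-end p

  module Unique (lem : ExcludedMiddle lzero) (cfpo : IsCFPO) where

    transport : ∀ {a b P Q s} → IsPath a b P → IsPath a b Q → P (ι s) → Q (ι s)
    transport {a} {b} {P} {Q} {s} p q = Equivalence.to (cfpo a b P Q p q (ι s))

    onPath-loop : ∀ {a s} → OnPath a a s → s ≡ a
    onPath-loop {a} (_ , p , s∈P) with transport p (singletonPath a) s∈P
    ... | _ , _ , lift s≈a = ι-injective s≈a

    onPath-trans : ∀ {a s t u} → OnPath a t s → OnPath a u t → OnPath a u s
    onPath-trans (_ , p , s∈P) (Q , q , t∈Q) with Along.initialPath-⊆ q lem t∈Q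
    ... | _ , r , R⊆Q = Q , q , R⊆Q _ (transport p r s∈P)

    onPath-antisym : ∀ {a s t} → OnPath a t s → OnPath a s t → s ≡ t
    onPath-antisym (_ , p , s∈P) (_ , q , t∈Q) with Along.initialPath-end p lem s∈P
    ... | _ , r , ends = ends (transport q r t∈Q)

    onPath-linear : ∀ {a x y z} → OnPath a x y → OnPath a x z → OnPath a z y ⊎ OnPath a y z
    onPath-linear (_ , p , y∈P) (_ , q , z∈Q) = Along.path-points-linear p lem y∈P (transport q p z∈Q)

module TreeOrder (lem : ExcludedMiddle lzero) (M : ColouredPO) (cfpo : CFPO.IsCFPO M)
                 (conn : CFPO.Connected M) (r : CFPO.A M) where
  open CFPO.T M r using (_≤T_)
  open Paths M
  open Unique lem cfpo

  ≤T-refl : ∀ t → t ≤T t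
  ≤T-refl t = inj₂ (onPath-refl conn r t)

  ≤T-trans : ∀ {s t u} → s ≤T t → t ≤T u → s ≤T u
  ≤T-trans (inj₁ s≡r)  _            = inj₁ s≡r
  ≤T-trans (inj₂ s-on) (inj₁ refl)  = inj₁ (onPath-loop s-on)
  ≤T-trans (inj₂ s-on) (inj₂ t-on)  = inj₂ (onPath-trans s-on t-on)

  ≤T-antisym : ∀ {s t} → s ≤T t → t ≤T s → s ≡ t
  ≤T-antisym (inj₁ refl)  (inj₁ refl)  = refl
  ≤T-antisym (inj₁ refl)  (inj₂ t-on)  = sym (onPath-loop t-on)
  ≤T-antisym (inj₂ s-on)  (inj₁ refl)  = onPath-loop s-on
  ≤T-antisym (inj₂ s-on)  (inj₂ t-on)  = onPath-antisym s-on t-on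

  ≤T-downLinear : ∀ x y z → y ≤T x → z ≤T x → y ≤T z ⊎ z ≤T y
  ≤T-downLinear _ _ _ (inj₁ y≡r)  _           = inj₁ (inj₁ y≡r)
  ≤T-downLinear _ _ _ (inj₂ _)    (inj₁ z≡r)  = inj₂ (inj₁ z≡r)
  ≤T-downLinear _ _ _ (inj₂ y-on) (inj₂ z-on) = Sum.map inj₂ inj₂ (onPath-linear y-on z-on)

mainTheorem1 : (∀ {ℓ} → ExcludedMiddle ℓ) → (M : ColouredPO) →
    CFPO.IsCFPO M → CFPO.Connected M → (r : CFPO.A M) →
    (∀ (φ : CFPO.Automorphism M) → CFPO.Automorphism.fun φ r ≡ r) →
    IsTree (CFPO.T._≤T_ M r)
mainTheorem1 lem M cfpo conn r _ = record
  { isPartialOrder = record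
    { isPreorder = record
      { isEquivalence = isEquivalence
      ; reflexive     = λ { refl → ≤T-refl _ }
      ; trans         = ≤T-trans
      }
    ; antisym = ≤T-antisym
    }
  ; downLinear  = ≤T-downLinear
  ; commonLower = λ _ _ → r , inj₁ refl , inj₁ refl
  }
  where open TreeOrder lem M cfpo conn r
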